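{- The set of increasing Cayley trees is in record duality with the set of subexceedant parking functions, i.e. $\{\pi_T: T\text{ increasing}\}$ is exactly the set of sequences $(a_1,\dots,a_n)$, $n\ge0$, with $1\le a_i\le i$ for all $i$. Consequently $$\sum_{T\text{ increasing}} y^{\mathrm{wait}(T)}z^{\mathrm{psa}(T)}t^{\deg_\circ(T)}w^{\mathrm{chseq}(T)}q^{\mathrm{ord}(T)}=\sum_{\pi\text{ subexceedant}} y^{\mathrm{probes}(\pi)}z^{\mathrm{lucky}(\pi)}t^{\mathrm{ones}(\pi)}w^{\mathrm{mult}(\pi)}q^{\mathrm{len}(\pi)},$$ with $w^{(b_1,\dots,b_k)}=w_{b_1}\cdots w_{b_k}$.
   Context: Cayley trees: trees on $[n]_0=\{0,\dots,n\}$ ($n\ge0$) rooted at $0$, parent map $f_T$; $T$ is increasing if $f_T(i)<i$ for all $i\in[n]$. Weary permutation $\omega_T$: priority-first search from $0$ (visit at each step the smallest unvisited vertex adjacent to a visited one); $\omega_T(i)$ = $i$-th non-root vertex visited, $\omega_T(0)=0$. Preference sequence $\pi_T(i)=\omega_T^{ -1}(f_T(i))+1$. $\mathrm{pt}(T)$ is $T$ with each $v$ relabelled $\omega_T^{ -1}(v)$. $\mathrm{ord}(T)=n$; $\deg_\circ(T)$ = number of children of $0$; $\mathrm{chseq}(T)=(\tau_0,\dots,\tau_n)$, $\tau_i$ = number of vertices (root included) with exactly $i$ children; $\mathrm{wait}(T)=\sum_{i=1}^n(i-f_{\mathrm{pt}(T)}(i))$; $\mathrm{psa}(T)=\#\{i: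 f_{\mathrm{pt}(T)}(i)=i-1\}$. Parking function $\pi=(a_1,\dots,a_n)$, $a_i\in[n]$: cars $1,\dots,n$ enter in order a street with spots $1,\dots,n$, car $i$ parks in the first free spot $j\ge a_i$, and all cars park. $\mathrm{len}(\pi)=n$; $\mathrm{lucky}(\pi)$ = number of cars parking in their preferred spot; $\mathrm{probes}(\pi)=n+\sum(\text{final spot}-\text{preferred spot})$; $\mathrm{ones}(\pi)=\#\{i:a_i=1\}$; $\mathrm{mult}(\pi)=(\mu_0,\dots,\mu_n)$, $\mu_i$ = number of elements of $[n+1]$ appearing exactly $i$ times. The sums are formal power series (graded by $q$). -}

module Defs where

open import Data.Bool using (Bool; true; false; _∧_; _∨_; not; if_then_else_)
open import Data.Nat using (ℕ; zero; suc; _+_; _∸_; _≡ᵇ_; _<ᵇ_; _≤ᵇ_)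
open import Data.List using (List; []; _∷_; map; length; concatMap; zip; _++_)
open import Data.Nat.ListAction using (sum)
open import Data.Maybe using (Maybe; just; nothing; fromMaybe; is-just)
open import Data.Product using (_×_; _,_)
import Data.Product

range : ℕ → ℕ → List ℕ
range lo zero = []
range lo (suc k) = lo ∷ range (suc lo) k

-- interval lo hi = [lo, ..., hi]  (empty if hi < lo)
interval : ℕ → ℕ → List ℕ
interval lo hi = range lo (suc hi ∸ lo)

bfilter : {A : Set} → (A → Bool) → List A → List A
bfilter p [] = []
bfilter p (x ∷ xs) = if p x then x ∷ bfilter p xs else bfilter p xs

count : {A : Set} → (A → Bool) → List A → ℕ
count p xs = length (bfilter p xs)

anyB : {A : Set} → (A → Bool) → List A → Bool
anyB p [] = false
anyB p (x ∷ xs) = p x ∨ anyB p xs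

allB : {A : Set} → (A → Bool) → List A → Bool
allB p [] = true
allB p (x ∷ xs) = p x ∧ allB p xs

memberB : ℕ → List ℕ → Bool
memberB v = anyB (λ u → u ≡ᵇ v)

-- 0-based lookup with default 0
at : List ℕ → ℕ → ℕ
at [] _ = 0
at (x ∷ xs) zero = x
at (x ∷ xs) (suc i) = at xs i

-- 0-based position of v in a list (length of list if absent)
indexOf : ℕ → List ℕ → ℕ
indexOf v [] = 0
indexOf v (x ∷ xs) = if x ≡ᵇ v then 0 else suc (indexOf v xs)

headM : List ℕ → Maybe ℕ
headM [] = nothing
headM (x ∷ _) = just x

seqs : ℕ → List ℕ → List (List ℕ)
seqs zero xs = [] ∷ []
seqs (suc n) xs = concatMap (λ x → map (x ∷_) (seqs n xs)) xs

-- exponent vector of w^(b_1,...,b_k) = w_{b_1}...w_{b_k}, recorded for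
-- the variables w_0, ..., w_{n+1} (all indices occurring for order/length n)
wExp : ℕ → List ℕ → List ℕ
wExp n bs = map (λ j → count (λ b → b ≡ᵇ j) bs) (interval 0 (suc n))

-- a monomial y^a z^b t^c w^(exponents) q^d
Monomial : Set
Monomial = ℕ × ℕ × ℕ × List ℕ × ℕ

-- Cayley trees on [n]_0 rooted at 0, given by the parent map:
-- T = (f(1), ..., f(n)), so ord(T) = length T.

ordT : List ℕ → ℕ
ordT T = length T

par : List ℕ → ℕ → ℕ
par T i = at T (i ∸ 1)

reach : List ℕ → ℕ → ℕ → Bool
reach T k zero = true
reach T zero (suc v) = false
reach T (suc k) (suc v) = reach T k (par T (suc v))

isCayley : List ℕ → Bool
isCayley T = allB (λ x → x ≤ᵇ ordT T) T
           ∧ allB (λ i → reach T (ordT T) i) (interval 1 (ordT T))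

isIncreasing : List ℕ → Bool
isIncreasing T = allB (λ i → par T i <ᵇ i) (interval 1 (ordT T))

isIncTree : List ℕ → Bool
isIncTree T = isCayley T ∧ isIncreasing T

incTrees : ℕ → List (List ℕ)
incTrees n = bfilter isIncTree (seqs n (interval 0 n))

adj : List ℕ → ℕ → ℕ → Bool
adj T u v = (not (v ≡ᵇ 0) ∧ (par T v ≡ᵇ u)) ∨ (not (u ≡ᵇ 0) ∧ (par T u ≡ᵇ v))

-- priority-first search: visited list (in visiting order, starting with 0);
-- at each step visit the smallest unvisited vertex adjacent to a visited one
pfsStep : List ℕ → List ℕ → Maybe ℕ
pfsStep T vis = headM (bfilter (λ v → not (memberB v vis) ∧ anyB (λ u → adj T u v) vis)
                               (interval 1 (ordT T)))

pfs : List ℕ → ℕ → List ℕ → List ℕ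
pfs T zero vis = vis
pfs T (suc k) vis with pfsStep T vis
... | nothing = vis
... | just v = pfs T k (vis ++ (v ∷ []))

-- [ω_T(0), ω_T(1), ..., ω_T(n)] with ω_T(0) = 0
wearyList : List ℕ → List ℕ
wearyList T = pfs T (ordT T) (0 ∷ [])

weary : List ℕ → ℕ → ℕ
weary T j = at (wearyList T) j

wearyInv : List ℕ → ℕ → ℕ
wearyInv T v = indexOf v (wearyList T)

prefSeq : List ℕ → List ℕ
prefSeq T = map (λ i → suc (wearyInv T (par T i))) (interval 1 (ordT T))

-- parent map of pt(T): f_{pt(T)}(j) = ω^{-1}(f_T(ω(j)))
ptPar : List ℕ → ℕ → ℕ
ptPar T j = wearyInv T (par T (weary T j))

wait : List ℕ → ℕ
wait T = sum (map (λ j → j ∸ ptPar T j) (interval 1 (ordT T)))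

psa : List ℕ → ℕ
psa T = count (λ j → ptPar T j ≡ᵇ (j ∸ 1)) (interval 1 (ordT T))

degRoot : List ℕ → ℕ
degRoot T = count (λ i → par T i ≡ᵇ 0) (interval 1 (ordT T))

children : List ℕ → ℕ → ℕ
children T v = count (λ i → par T i ≡ᵇ v) (interval 1 (ordT T))

chseq : List ℕ → List ℕ
chseq T = map (λ k → count (λ v → children T v ≡ᵇ k) (interval 0 (ordT T)))
              (interval 0 (ordT T))

treeMono : List ℕ → Monomial
treeMono T = wait T , psa T , degRoot T , wExp (ordT T) (chseq T) , ordT T

lenP : List ℕ → ℕ
lenP π = length π

firstFree : ℕ → List ℕ → ℕ → Maybe ℕ
firstFree n occ a = headM (bfilter (λ j → not (memberB j occ)) (interval a n))

parkAll : ℕ → List ℕ → List ℕ → Maybe (List ℕ)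
parkAll n occ [] = just []
parkAll n occ (a ∷ as) with firstFree n occ a
... | nothing = nothing
... | just j with parkAll n (j ∷ occ) as
...   | nothing = nothing
...   | just js = just (j ∷ js)

isPF : List ℕ → Bool
isPF π = allB (λ a → (1 ≤ᵇ a) ∧ (a ≤ᵇ lenP π)) π ∧ is-just (parkAll (lenP π) [] π)

spots : List ℕ → List ℕ
spots π = fromMaybe [] (parkAll (lenP π) [] π)

isSubex : List ℕ → Bool
isSubex π =
            allB (λ p → (1 ≤ᵇ Data.Product.proj₂ p) ∧ (Data.Product.proj₂ p ≤ᵇ Data.Product.proj₁ p))
                 (zip (interval 1 (lenP π)) π)

subexPFs : ℕ → List (List ℕ)
subexPFs n = bfilter (λ π → isPF π ∧ isSubex π) (seqs n (interval 1 n))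

lucky : List ℕ → ℕ
lucky π = count (λ p → Data.Product.proj₁ p ≡ᵇ Data.Product.proj₂ p) (zip (spots π) π)

probes : List ℕ → ℕ
probes π = lenP π + sum (map (λ p → Data.Product.proj₁ p ∸ Data.Product.proj₂ p) (zip (spots π) π))

ones : List ℕ → ℕ
ones π = count (λ a → a ≡ᵇ 1) π

mult : List ℕ → List ℕ
mult π = map (λ k → count (λ x → count (λ a → a ≡ᵇ x) π ≡ᵇ k) (interval 1 (suc (lenP π))))
             (interval 0 (lenP π))

pfMono : List ℕ → Monomial
pfMono π = probes π , lucky π , ones π , wExp (lenP π) (mult π) , lenP π

{-# OPTIONS --safe #-}
-- In an increasing tree T = (f(1), …, f(n)) the parent f(i) < i of each vertex i is already
-- visited when i is the smallest unvisited vertex, so priority-first search visits 0, 1, …, n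
-- in order: ω_T is the identity, pt(T) = T and π_T = (f(1) + 1, …, f(n) + 1). Thus T ↦ π_T is
-- "add one", a bijection onto the subexceedant sequences. In such a sequence car i finds the
-- spots 1, …, i − 1 taken and spot i free, so it parks in spot i. The statistics then agree
-- term by term: car i is displaced by i − 1 − f(i) (probes = wait), it is lucky iff
-- f(i) = i − 1 (lucky = psa), a_i = 1 iff f(i) = 0 (ones = deg∘), and the value v + 1 occurs
-- in π_T as often as v has children in T (mult = chseq).
module Submission where

open import Defs
open import Data.Nat
  using (ℕ; zero; suc; _+_; _∸_; _≡ᵇ_; _<ᵇ_; _≤ᵇ_; _≤_; _<_; z≤n; s≤s; s≤s⁻¹; z<s; pred)
open import Data.Nat.Properties
open import Data.Nat.ListAction using (sum)
open import Data.Bool using (Bool; true; false; T; _∧_; _∨_; not; if_then_else_)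
open import Data.Bool.Properties using (T-≡; ∧-zeroʳ; ∨-zeroʳ)
open import Data.List using (List; []; _∷_; [_]; map; length; zip; _++_; concatMap)
open import Data.List.Properties
  using ( map-∘; map-cong; map-cong-local; length-map; concatMap-map; concatMap-cong
        ; concatMap-++; map-concatMap; ++-identityʳ )
open import Data.List.Relation.Unary.All as All using (All; []; _∷_)
open import Data.List.Relation.Unary.All.Properties using (map⁺; concat⁺; All¬⇒¬Any)
open import Data.List.Relation.Unary.Any using (here; there)
open import Data.List.Membership.Propositional using (_∈_; _∉_)
open import Data.List.Relation.Binary.Permutation.Propositional using (_↭_; ↭-reflexive)
open import Data.Maybe using (just; fromMaybe; is-just)
open import Data.Product using (Σ; _×_; _,_; proj₁; proj₂)
open import Data.Empty using (⊥-elim)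
open import Function using (_∘_)
open import Function.Bundles using (_⇔_; mk⇔; Equivalence)
open import Relation.Nullary using (yes; no)
open import Relation.Binary.PropositionalEquality
  using (_≡_; refl; sym; trans; cong; cong₂; subst; module ≡-Reasoning)
open ≡-Reasoning

private
  variable
    A B : Set

T⇒≡true : ∀ {b} → T b → b ≡ true
T⇒≡true = Equivalence.to T-≡

<ᵇ≡true⇒< : ∀ m n → (m <ᵇ n) ≡ true → m < n
<ᵇ≡true⇒< m n e = <ᵇ⇒< m n (Equivalence.from T-≡ e)

≡ᵇ-refl : ∀ n → (n ≡ᵇ n) ≡ true
≡ᵇ-refl n = T⇒≡true (≡⇒≡ᵇ n n refl)

≡ᵇ-sym : ∀ m n → (m ≡ᵇ n) ≡ (n ≡ᵇ m)
≡ᵇ-sym zero    zero    = refl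
≡ᵇ-sym zero    (suc n) = refl
≡ᵇ-sym (suc m) zero    = refl
≡ᵇ-sym (suc m) (suc n) = ≡ᵇ-sym m n

<ᵇ-irrefl : ∀ n → (n <ᵇ n) ≡ false
<ᵇ-irrefl zero    = refl
<ᵇ-irrefl (suc n) = <ᵇ-irrefl n

<ᵇ-suc : ∀ j m → (j <ᵇ suc m) ≡ (m ≡ᵇ j) ∨ (j <ᵇ m)
<ᵇ-suc zero    zero    = refl
<ᵇ-suc zero    (suc m) = refl
<ᵇ-suc (suc j) zero    = refl
<ᵇ-suc (suc j) (suc m) = <ᵇ-suc j m

∧-redundantˡ : ∀ {a b} → (b ≡ true → a ≡ true) → a ∧ b ≡ b
∧-redundantˡ {a} {true}  b⇒a rewrite b⇒a refl = refl
∧-redundantˡ {a} {false} _   = ∧-zeroʳ a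

m<n⇒n∸m≡suc[n∸suc[m]] : ∀ {m n} → m < n → n ∸ m ≡ suc (n ∸ suc m)
m<n⇒n∸m≡suc[n∸suc[m]] {m} {suc n} (s≤s m≤n) = +-∸-assoc 1 m≤n

allB-complete : ∀ {p : A → Bool} {xs} → All (λ x → p x ≡ true) xs → allB p xs ≡ true
allB-complete []         = refl
allB-complete (px ∷ pxs) rewrite px = allB-complete pxs

allB-sound : ∀ (p : A → Bool) xs → allB p xs ≡ true → All (λ x → p x ≡ true) xs
allB-sound p []       _ = []
allB-sound p (x ∷ xs) e with p x in px
allB-sound p (x ∷ xs) e  | true  = px ∷ allB-sound p xs e
allB-sound p (x ∷ xs) () | false

allB-map : ∀ (p : B → Bool) (g : A → B) xs → allB p (map g xs) ≡ allB (λ x → p (g x)) xs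
allB-map p g []       = refl
allB-map p g (x ∷ xs) = cong (p (g x) ∧_) (allB-map p g xs)

anyB-map : ∀ (p : B → Bool) (g : A → B) xs → anyB p (map g xs) ≡ anyB (λ x → p (g x)) xs
anyB-map p g []       = refl
anyB-map p g (x ∷ xs) = cong (p (g x) ∨_) (anyB-map p g xs)

bfilter-map : ∀ (p : B → Bool) (g : A → B) xs →
              bfilter p (map g xs) ≡ map g (bfilter (λ x → p (g x)) xs)
bfilter-map p g []       = refl
bfilter-map p g (x ∷ xs) with p (g x)
... | true  = cong (g x ∷_) (bfilter-map p g xs)
... | false = bfilter-map p g xs

bfilter-++ : ∀ (p : A → Bool) xs ys → bfilter p (xs ++ ys) ≡ bfilter p xs ++ bfilter p ys
bfilter-++ p []       ys = refl
bfilter-++ p (x ∷ xs) ys with p x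
... | true  = cong (x ∷_) (bfilter-++ p xs ys)
... | false = bfilter-++ p xs ys

bfilter-concatMap : ∀ (p : B → Bool) (f : A → List B) xs →
                    bfilter p (concatMap f xs) ≡ concatMap (λ x → bfilter p (f x)) xs
bfilter-concatMap p f []       = refl
bfilter-concatMap p f (x ∷ xs) =
  trans (bfilter-++ p (f x) (concatMap f xs)) (cong (bfilter p (f x) ++_) (bfilter-concatMap p f xs))

bfilter-cong-local : ∀ {p q : A → Bool} {xs} →
                     All (λ x → p x ≡ q x) xs → bfilter p xs ≡ bfilter q xs
bfilter-cong-local []                         = refl
bfilter-cong-local {q = q} {x ∷ _} (e ∷ es) rewrite e =
  cong (λ ys → if q x then x ∷ ys else ys) (bfilter-cong-local es)

bfilter-none : ∀ {p : A → Bool} {xs} → All (λ x → p x ≡ false) xs → bfilter p xs ≡ []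
bfilter-none []       = refl
bfilter-none (e ∷ es) rewrite e = bfilter-none es

bfilter-All : ∀ (p : A → Bool) xs → All (λ x → p x ≡ true) (bfilter p xs)
bfilter-All p []       = []
bfilter-All p (x ∷ xs) with p x in px
... | true  = px ∷ bfilter-All p xs
... | false = bfilter-All p xs

count-map : ∀ (p : B → Bool) (g : A → B) xs → count p (map g xs) ≡ count (λ x → p (g x)) xs
count-map p g xs = trans (cong length (bfilter-map p g xs)) (length-map g (bfilter (λ x → p (g x)) xs))

count-cong-local : ∀ {p q : A → Bool} {xs} → All (λ x → p x ≡ q x) xs → count p xs ≡ count q xs
count-cong-local = cong length ∘ bfilter-cong-local

sum-map-suc : ∀ (f : A → ℕ) xs → sum (map (λ x → suc (f x)) xs) ≡ length xs + sum (map f xs)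
sum-map-suc f []       = refl
sum-map-suc f (x ∷ xs) = cong suc (begin
  f x + sum (map (λ x → suc (f x)) xs) ≡⟨ cong (f x +_) (sum-map-suc f xs) ⟩
  f x + (length xs + sum (map f xs))   ≡⟨ sym (+-assoc (f x) _ _) ⟩
  f x + length xs + sum (map f xs)     ≡⟨ cong (_+ sum (map f xs)) (+-comm (f x) _) ⟩
  length xs + f x + sum (map f xs)     ≡⟨ +-assoc (length xs) _ _ ⟩
  length xs + (f x + sum (map f xs))   ∎)

zip-map-self : ∀ (f : A → B) xs → zip xs (map f xs) ≡ map (λ x → x , f x) xs
zip-map-self f []       = refl
zip-map-self f (x ∷ xs) = cong ((x , f x) ∷_) (zip-map-self f xs)

range-suc : ∀ lo k → range (suc lo) k ≡ map suc (range lo k)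
range-suc lo zero    = refl
range-suc lo (suc k) = cong (suc lo ∷_) (range-suc (suc lo) k)

length-range : ∀ lo k → length (range lo k) ≡ k
length-range lo zero    = refl
length-range lo (suc k) = cong suc (length-range (suc lo) k)

range-snoc : ∀ lo k → range lo (suc k) ≡ range lo k ++ [ lo + k ]
range-snoc lo zero    = cong [_] (sym (+-identityʳ lo))
range-snoc lo (suc k) = cong (lo ∷_) (begin
  range (suc lo) (suc k)             ≡⟨ range-snoc (suc lo) k ⟩
  range (suc lo) k ++ [ suc lo + k ] ≡⟨ cong (λ j → range (suc lo) k ++ [ j ]) (sym (+-suc lo k)) ⟩
  range (suc lo) k ++ [ lo + suc k ] ∎)

range-< : ∀ lo k → All (_< lo + k) (range lo k)
range-< lo zero    = []
range-< lo (suc k) =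
  m<m+n lo z<s ∷ subst (λ b → All (_< b) (range (suc lo) k)) (sym (+-suc lo k)) (range-< (suc lo) k)

∈-range : ∀ lo {i k} → i < k → lo + i ∈ range lo k
∈-range lo {zero}  {suc k} _         = here (+-identityʳ lo)
∈-range lo {suc i} {suc k} (s≤s i<k) =
  there (subst (_∈ range (suc lo) k) (sym (+-suc lo i)) (∈-range (suc lo) i<k))

at-range : ∀ lo {j k} → j < k → at (range lo k) j ≡ lo + j
at-range lo {zero}  {suc k} _         = sym (+-identityʳ lo)
at-range lo {suc j} {suc k} (s≤s j<k) = trans (at-range (suc lo) j<k) (sym (+-suc lo j))

map-at-range : ∀ xs → map (at xs) (range 0 (length xs)) ≡ xs
map-at-range []       = refl
map-at-range (x ∷ xs) = cong (x ∷_) (begin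
  map (at (x ∷ xs)) (range 1 (length xs))           ≡⟨ cong (map (at (x ∷ xs))) (range-suc 0 (length xs)) ⟩
  map (at (x ∷ xs)) (map suc (range 0 (length xs))) ≡⟨ sym (map-∘ (range 0 (length xs))) ⟩
  map (at xs) (range 0 (length xs))                 ≡⟨ map-at-range xs ⟩
  xs                                                ∎)

memberB-range : ∀ v k → memberB v (range 0 k) ≡ (v <ᵇ k)
memberB-range v       zero    = refl
memberB-range zero    (suc k) = refl
memberB-range (suc v) (suc k) = begin
  memberB (suc v) (range 1 k)           ≡⟨ cong (memberB (suc v)) (range-suc 0 k) ⟩
  memberB (suc v) (map suc (range 0 k)) ≡⟨ anyB-map (λ u → u ≡ᵇ suc v) suc (range 0 k) ⟩
  memberB v (range 0 k)                 ≡⟨ memberB-range v k ⟩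
  v <ᵇ k                                ∎

anyB-range : ∀ (p : ℕ → Bool) {i k} → i < k → p i ≡ true → anyB p (range 0 k) ≡ true
anyB-range p {zero}  {suc k} _         pi rewrite pi = refl
anyB-range p {suc i} {suc k} (s≤s i<k) pi = begin
  p 0 ∨ anyB p (range 1 k)           ≡⟨ cong (λ r → p 0 ∨ anyB p r) (range-suc 0 k) ⟩
  p 0 ∨ anyB p (map suc (range 0 k)) ≡⟨ cong (p 0 ∨_) (anyB-map p suc (range 0 k)) ⟩
  p 0 ∨ anyB (p ∘ suc) (range 0 k)   ≡⟨ cong (p 0 ∨_) (anyB-range (p ∘ suc) i<k pi) ⟩
  p 0 ∨ true                         ≡⟨ ∨-zeroʳ (p 0) ⟩
  true                               ∎

indexOf-map-suc : ∀ v xs → indexOf (suc v) (map suc xs) ≡ indexOf v xs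
indexOf-map-suc v []       = refl
indexOf-map-suc v (x ∷ xs) = cong (λ r → if x ≡ᵇ v then 0 else suc r) (indexOf-map-suc v xs)

indexOf-range : ∀ {v k} → v < k → indexOf v (range 0 k) ≡ v
indexOf-range {zero}  {suc k} _         = refl
indexOf-range {suc v} {suc k} (s≤s v<k) = cong suc (begin
  indexOf (suc v) (range 1 k)           ≡⟨ cong (indexOf (suc v)) (range-suc 0 k) ⟩
  indexOf (suc v) (map suc (range 0 k)) ≡⟨ indexOf-map-suc v (range 0 k) ⟩
  indexOf v (range 0 k)                 ≡⟨ indexOf-range v<k ⟩
  v                                     ∎)

headM-bfilter-range : ∀ (q : ℕ → Bool) {lo k t} → lo ≤ t → t < lo + k →
                      (∀ {v} → lo ≤ v → v < t → q v ≡ false) → q t ≡ true →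
                      headM (bfilter q (range lo k)) ≡ just t
headM-bfilter-range q {lo} {zero} lo≤t t<lo _ _ =
  ⊥-elim (<⇒≱ (subst (_ <_) (+-identityʳ lo) t<lo) lo≤t)
headM-bfilter-range q {lo} {suc k} {t} lo≤t t<lo+k before qt with lo ≟ t
... | yes refl rewrite qt = refl
... | no lo≢t rewrite before ≤-refl (≤∧≢⇒< lo≤t lo≢t) =
  headM-bfilter-range q (≤∧≢⇒< lo≤t lo≢t) (subst (t <_) (+-suc lo k) t<lo+k) (before ∘ <⇒≤) qt

seqs-map : ∀ k (g : ℕ → ℕ) xs → seqs k (map g xs) ≡ map (map g) (seqs k xs)
seqs-map zero    g xs = refl
seqs-map (suc k) g xs = begin
  concatMap (λ y → map (y ∷_) (seqs k (map g xs))) (map g xs)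
    ≡⟨ concatMap-map (λ y → map (y ∷_) (seqs k (map g xs))) g xs ⟩
  concatMap (λ x → map (g x ∷_) (seqs k (map g xs))) xs
    ≡⟨ concatMap-cong (λ x → cong (map (g x ∷_)) (seqs-map k g xs)) xs ⟩
  concatMap (λ x → map (g x ∷_) (map (map g) (seqs k xs))) xs
    ≡⟨ concatMap-cong (λ x → trans (sym (map-∘ (seqs k xs))) (map-∘ (seqs k xs))) xs ⟩
  concatMap (λ x → map (map g) (map (x ∷_) (seqs k xs))) xs
    ≡⟨ sym (map-concatMap (map g) (λ x → map (x ∷_) (seqs k xs)) xs) ⟩
  map (map g) (concatMap (λ x → map (x ∷_) (seqs k xs)) xs)
    ∎

length-seqs : ∀ k xs → All (λ s → length s ≡ k) (seqs k xs)
length-seqs zero    xs = refl ∷ []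
length-seqs (suc k) xs =
  concat⁺ (map⁺ (All.universal (λ _ → map⁺ (All.map (cong suc) (length-seqs k xs))) xs))

bfilter-seqs-suc : ∀ (p : List ℕ → Bool) k xs →
                   bfilter p (seqs (suc k) xs)
                     ≡ concatMap (λ x → map (x ∷_) (bfilter (λ s → p (x ∷ s)) (seqs k xs))) xs
bfilter-seqs-suc p k xs =
  trans (bfilter-concatMap p (λ x → map (x ∷_) (seqs k xs)) xs)
        (concatMap-cong (λ x → bfilter-map p (x ∷_) (seqs k xs)) xs)

bfilter-seqs-unused : ∀ k (p : List ℕ → Bool) ys z →
                      (∀ s → length s ≡ k → p s ≡ true → z ∉ s) →
                      bfilter p (seqs k (ys ++ [ z ])) ≡ bfilter p (seqs k ys)
bfilter-seqs-unused zero    p ys z avoids = refl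
bfilter-seqs-unused (suc k) p ys z avoids = begin
  bfilter p (seqs (suc k) (ys ++ [ z ]))
    ≡⟨ bfilter-seqs-suc p k (ys ++ [ z ]) ⟩
  concatMap (extend (ys ++ [ z ])) (ys ++ [ z ])
    ≡⟨ concatMap-cong (λ x → cong (map (x ∷_)) (bfilter-seqs-unused k _ ys z (avoids-tail x)))
                      (ys ++ [ z ]) ⟩
  concatMap (extend ys) (ys ++ [ z ])
    ≡⟨ concatMap-++ (extend ys) ys [ z ] ⟩
  concatMap (extend ys) ys ++ map (z ∷_) (bfilter (λ s → p (z ∷ s)) (seqs k ys)) ++ []
    ≡⟨ cong (λ zs → concatMap (extend ys) ys ++ map (z ∷_) zs ++ [])
            (bfilter-none (All.map rejects-z (length-seqs k ys))) ⟩
  concatMap (extend ys) ys ++ []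
    ≡⟨ ++-identityʳ _ ⟩
  concatMap (extend ys) ys
    ≡⟨ sym (bfilter-seqs-suc p k ys) ⟩
  bfilter p (seqs (suc k) ys)
    ∎
  where
  extend : List ℕ → ℕ → List (List ℕ)
  extend zs x = map (x ∷_) (bfilter (λ s → p (x ∷ s)) (seqs k zs))

  avoids-tail : ∀ x s → length s ≡ k → p (x ∷ s) ≡ true → z ∉ s
  avoids-tail x s len px∷s z∈s = avoids (x ∷ s) (cong suc len) px∷s (there z∈s)

  rejects-z : ∀ {s} → length s ≡ k → p (z ∷ s) ≡ false
  rejects-z {s} len with p (z ∷ s) in pz∷s
  ... | true  = ⊥-elim (avoids (z ∷ s) (cong suc len) pz∷s (here refl))
  ... | false = refl

-- A record rather than a synonym for the All, so that T can be inferred from a proof.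
record Increasing (T : List ℕ) : Set where
  constructor increasing
  field
    parent< : All (λ i → par T i < i) (interval 1 (ordT T))
open Increasing

map-par : ∀ T → map (par T) (interval 1 (ordT T)) ≡ T
map-par T = begin
  map (par T) (range 1 (length T))           ≡⟨ cong (map (par T)) (range-suc 0 (length T)) ⟩
  map (par T) (map suc (range 0 (length T))) ≡⟨ sym (map-∘ (range 0 (length T))) ⟩
  map (at T) (range 0 (length T))            ≡⟨ map-at-range T ⟩
  T                                          ∎

count-par : ∀ (q : ℕ → Bool) T → count (λ i → q (par T i)) (interval 1 (ordT T)) ≡ count q T
count-par q T = trans (sym (count-map q (par T) (interval 1 (ordT T)))) (cong (count q) (map-par T))

isIncreasing⇒Increasing : ∀ T → isIncreasing T ≡ true → Increasing T
isIncreasing⇒Increasing T e = increasing (All.map (λ {i} → <ᵇ≡true⇒< (par T i) i) (allB-sound _ _ e))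

vertex-≤ : ∀ n → All (_≤ n) (interval 1 n)
vertex-≤ n = All.map s≤s⁻¹ (range-< 1 n)

parent-≤ : ∀ {T} → Increasing T → ∀ {j} → j < ordT T → par T (suc j) ≤ j
parent-≤ inc j<n = s≤s⁻¹ (All.lookup (parent< inc) (∈-range 1 j<n))

entries-< : ∀ {T} → Increasing T → All (_< ordT T) T
entries-< {T} inc = subst (All (_< ordT T)) (map-par T)
  (map⁺ (All.zipWith (λ (p<i , i≤n) → <-≤-trans p<i i≤n) (parent< inc , vertex-≤ (ordT T))))

reach-root : ∀ {T} → Increasing T → ∀ {k v} → v ≤ k → k ≤ ordT T → reach T k v ≡ true
reach-root inc {k}     {zero}  _         _   = refl
reach-root inc {suc k} {suc v} (s≤s v≤k) k<n =
  reach-root inc (≤-trans (parent-≤ inc (≤-trans (s≤s v≤k) k<n)) v≤k) (<⇒≤ k<n)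

isCayley-increasing : ∀ {T} → Increasing T → isCayley T ≡ true
isCayley-increasing {T} inc = cong₂ _∧_
  (allB-complete (All.map (λ x<n → T⇒≡true (≤⇒≤ᵇ (<⇒≤ x<n))) (entries-< inc)))
  (allB-complete (All.map (λ i≤n → reach-root inc i≤n ≤-refl) (vertex-≤ (ordT T))))

isIncTree≡isIncreasing : ∀ T → isIncTree T ≡ isIncreasing T
isIncTree≡isIncreasing T = ∧-redundantˡ (isCayley-increasing ∘ isIncreasing⇒Increasing T)

isIncTree⇒Increasing : ∀ T → isIncTree T ≡ true → Increasing T
isIncTree⇒Increasing T e = isIncreasing⇒Increasing T (trans (sym (isIncTree≡isIncreasing T)) e)

adj-parent : ∀ T m → adj T (par T (suc m)) (suc m) ≡ true
adj-parent T m rewrite ≡ᵇ-refl (par T (suc m)) = refl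

pfsStep-increasing : ∀ {T} → Increasing T → ∀ {m} → m < ordT T →
                     pfsStep T (range 0 (suc m)) ≡ just (suc m)
pfsStep-increasing {T} inc {m} m<n = headM-bfilter-range _ (s≤s z≤n) (s≤s m<n) visited next
  where
  frontier : ℕ → Bool
  frontier v = anyB (λ u → adj T u v) (range 0 (suc m))

  visited : ∀ {v} → 1 ≤ v → v < suc m → not (memberB v (range 0 (suc m))) ∧ frontier v ≡ false
  visited {v} _ v≤m =
    cong (λ b → not b ∧ frontier v) (trans (memberB-range v (suc m)) (T⇒≡true (<⇒<ᵇ v≤m)))

  next : not (memberB (suc m) (range 0 (suc m))) ∧ frontier (suc m) ≡ true
  next = trans (cong (λ b → not b ∧ frontier (suc m)) (trans (memberB-range (suc m) (suc m)) (<ᵇ-irrefl m)))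
               (anyB-range _ (s≤s (parent-≤ inc m<n)) (adj-parent T m))

pfs-increasing : ∀ {T} → Increasing T → ∀ k {m} → m + k ≤ ordT T →
                 pfs T k (range 0 (suc m)) ≡ range 0 (suc (m + k))
pfs-increasing {T} inc zero    {m} _ = cong (λ j → range 0 (suc j)) (sym (+-identityʳ m))
pfs-increasing {T} inc (suc k) {m} m+k<n
  rewrite pfsStep-increasing inc (<-≤-trans (m<m+n m z<s) m+k<n) = begin
    pfs T k (range 0 (suc m) ++ [ suc m ]) ≡⟨ cong (pfs T k) (sym (range-snoc 0 (suc m))) ⟩
    pfs T k (range 0 (suc (suc m)))        ≡⟨ pfs-increasing inc k (subst (_≤ ordT T) (+-suc m k) m+k<n) ⟩
    range 0 (suc (suc m + k))              ≡⟨ cong (λ j → range 0 (suc j)) (sym (+-suc m k)) ⟩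
    range 0 (suc (m + suc k))              ∎

wearyList-increasing : ∀ {T} → Increasing T → wearyList T ≡ range 0 (suc (ordT T))
wearyList-increasing {T} inc = pfs-increasing inc (ordT T) ≤-refl

weary-increasing : ∀ {T} → Increasing T → ∀ {j} → j ≤ ordT T → weary T j ≡ j
weary-increasing {T} inc {j} j≤n =
  trans (cong (λ ω → at ω j) (wearyList-increasing inc)) (at-range 0 (s≤s j≤n))

wearyInv-increasing : ∀ {T} → Increasing T → ∀ {v} → v ≤ ordT T → wearyInv T v ≡ v
wearyInv-increasing {T} inc {v} v≤n =
  trans (cong (indexOf v) (wearyList-increasing inc)) (indexOf-range (s≤s v≤n))

ptPar≡par : ∀ {T} → Increasing T → All (λ i → ptPar T i ≡ par T i) (interval 1 (ordT T))
ptPar≡par {T} inc = All.zipWith pt-vertex (parent< inc , vertex-≤ (ordT T))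
  where
  pt-vertex : ∀ {i} → par T i < i × i ≤ ordT T → ptPar T i ≡ par T i
  pt-vertex (p<i , i≤n) = trans (cong (λ j → wearyInv T (par T j)) (weary-increasing inc i≤n))
                                (wearyInv-increasing inc (<⇒≤ (<-≤-trans p<i i≤n)))

prefSeq-increasing : ∀ {T} → Increasing T → prefSeq T ≡ map suc T
prefSeq-increasing {T} inc = begin
  map (λ i → suc (wearyInv T (par T i))) I
    ≡⟨ map-cong-local (All.zipWith relabel (parent< inc , vertex-≤ (ordT T))) ⟩
  map (λ i → suc (par T i)) I              ≡⟨ map-∘ I ⟩
  map suc (map (par T) I)                  ≡⟨ cong (map suc) (map-par T) ⟩
  map suc T                                ∎
  where
  I = interval 1 (ordT T)
  relabel : ∀ {i} → par T i < i × i ≤ ordT T → suc (wearyInv T (par T i)) ≡ suc (par T i)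
  relabel (p<i , i≤n) = cong suc (wearyInv-increasing inc (<⇒≤ (<-≤-trans p<i i≤n)))

FilledUpTo : ℕ → List ℕ → Set
FilledUpTo m occ = ∀ j → memberB (suc j) occ ≡ (j <ᵇ m)

filledUpTo-suc : ∀ {m occ} → FilledUpTo m occ → FilledUpTo (suc m) (suc m ∷ occ)
filledUpTo-suc {m} filled j = trans (cong ((m ≡ᵇ j) ∨_) (filled j)) (sym (<ᵇ-suc j m))

firstFree-filled : ∀ {n m occ x} → FilledUpTo m occ → x ≤ m → m < n →
                   firstFree n occ (suc x) ≡ just (suc m)
firstFree-filled {n} {m} {occ} {x} filled x≤m m<n =
  headM-bfilter-range _ (s≤s x≤m) within taken free
  where
  within : suc m < suc x + (n ∸ x)
  within = subst (suc m <_) (sym (cong suc (m+[n∸m]≡n (≤-trans x≤m (<⇒≤ m<n))))) (s≤s m<n)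

  taken : ∀ {v} → suc x ≤ v → v < suc m → not (memberB v occ) ≡ false
  taken {suc v} _ (s≤s v<m) = cong not (trans (filled v) (T⇒≡true (<⇒<ᵇ v<m)))

  free : not (memberB (suc m) occ) ≡ true
  free = cong not (trans (filled m) (<ᵇ-irrefl m))

parkAll-∷ : ∀ {n occ a as j js} → firstFree n occ a ≡ just j → parkAll n (j ∷ occ) as ≡ just js →
            parkAll n occ (a ∷ as) ≡ just (j ∷ js)
parkAll-∷ first rest rewrite first | rest = refl

parkAll-subexceedant : ∀ (f : ℕ → ℕ) {n} m k {occ} →
                       All (λ i → f i < i) (range (suc m) k) → m + k ≤ n → FilledUpTo m occ →
                       parkAll n occ (map (λ i → suc (f i)) (range (suc m) k)) ≡ just (range (suc m) k)
parkAll-subexceedant f m zero _ _ _ = refl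
parkAll-subexceedant f {n} m (suc k) {occ} (fm<m ∷ f<) m+k≤n filled =
  parkAll-∷ {n} {occ} {suc (f (suc m))}
    (firstFree-filled {n} {m} {occ} filled (s≤s⁻¹ fm<m) (<-≤-trans (m<m+n m z<s) m+k≤n))
    (parkAll-subexceedant f (suc m) k f< (subst (_≤ n) (+-suc m k) m+k≤n) (filledUpTo-suc {m} {occ} filled))

parkAll-increasing : ∀ {T} → Increasing T → ∀ {n} → ordT T ≤ n →
                     parkAll n [] (map suc T) ≡ just (interval 1 (ordT T))
parkAll-increasing {T} inc {n} n≤ = begin
  parkAll n [] (map suc T)                  ≡⟨ cong (λ xs → parkAll n [] (map suc xs)) (sym (map-par T)) ⟩
  parkAll n [] (map suc (map (par T) I))    ≡⟨ cong (parkAll n []) (sym (map-∘ I)) ⟩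
  parkAll n [] (map (λ i → suc (par T i)) I)
    ≡⟨ parkAll-subexceedant (par T) 0 (ordT T) (parent< inc) n≤ (λ _ → refl) ⟩
  just I                                     ∎
  where I = interval 1 (ordT T)

spots-increasing : ∀ {T} → Increasing T → spots (map suc T) ≡ interval 1 (ordT T)
spots-increasing {T} inc = cong (fromMaybe []) (parkAll-increasing inc (≤-reflexive (sym (length-map suc T))))

isPF-increasing : ∀ {T} → Increasing T → isPF (map suc T) ≡ true
isPF-increasing {T} inc =
  cong₂ _∧_ in-range (cong is-just (parkAll-increasing inc (≤-reflexive (sym (length-map suc T)))))
  where
  in-range : allB (λ a → (1 ≤ᵇ a) ∧ (a ≤ᵇ lenP (map suc T))) (map suc T) ≡ true
  in-range = trans (allB-map _ suc T) (allB-complete (All.map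
    (λ x<n → T⇒≡true (<⇒<ᵇ (<-≤-trans x<n (≤-reflexive (sym (length-map suc T)))))) (entries-< inc)))

zip-vertices : ∀ (g : ℕ → ℕ) T →
               zip (interval 1 (ordT T)) (map g T) ≡ map (λ i → i , g (par T i)) (interval 1 (ordT T))
zip-vertices g T = begin
  zip I (map g T)                   ≡⟨ cong (λ xs → zip I (map g xs)) (sym (map-par T)) ⟩
  zip I (map g (map (par T) I))     ≡⟨ cong (zip I) (sym (map-∘ I)) ⟩
  zip I (map (λ i → g (par T i)) I) ≡⟨ zip-map-self (λ i → g (par T i)) I ⟩
  map (λ i → i , g (par T i)) I     ∎
  where I = interval 1 (ordT T)

-- The last step is definitional: (1 ≤ᵇ suc p) ∧ (suc p ≤ᵇ i) computes to p <ᵇ i.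
isSubex-suc : ∀ T → isSubex (map suc T) ≡ isIncreasing T
isSubex-suc T = begin
  allB _ (zip (interval 1 (lenP (map suc T))) (map suc T))
    ≡⟨ cong (λ n → allB _ (zip (interval 1 n) (map suc T))) (length-map suc T) ⟩
  allB _ (zip (interval 1 (ordT T)) (map suc T))
    ≡⟨ cong (allB _) (zip-vertices suc T) ⟩
  allB _ (map (λ i → i , suc (par T i)) (interval 1 (ordT T)))
    ≡⟨ allB-map _ _ (interval 1 (ordT T)) ⟩
  isIncreasing T
    ∎

isSubex-positive : ∀ {a} → isSubex a ≡ true → map suc (map pred a) ≡ a
isSubex-positive = positive-from 1 _
  where
  positive-from : ∀ m a →
                  allB (λ p → (1 ≤ᵇ proj₂ p) ∧ (proj₂ p ≤ᵇ proj₁ p)) (zip (range m (length a)) a) ≡ true →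
                  map suc (map pred a) ≡ a
  positive-from m []          _ = refl
  positive-from m (suc x ∷ a) e with x <ᵇ m
  positive-from m (suc x ∷ a) e  | true  = cong (suc x ∷_) (positive-from (suc m) a e)
  positive-from m (suc x ∷ a) () | false

pairs-increasing : ∀ {T} → Increasing T →
                   zip (spots (map suc T)) (map suc T) ≡ map (λ i → i , suc (par T i)) (interval 1 (ordT T))
pairs-increasing {T} inc = trans (cong (λ s → zip s (map suc T)) (spots-increasing inc)) (zip-vertices suc T)

wait≡probes : ∀ {T} → Increasing T → wait T ≡ probes (map suc T)
wait≡probes {T} inc = begin
  sum (map (λ i → i ∸ ptPar T i) I)
    ≡⟨ cong sum (map-cong-local (All.zipWith displacement (ptPar≡par inc , parent< inc))) ⟩
  sum (map (λ i → suc (i ∸ suc (par T i))) I)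
    ≡⟨ sum-map-suc (λ i → i ∸ suc (par T i)) I ⟩
  length I + sum (map (λ i → i ∸ suc (par T i)) I)
    ≡⟨ cong₂ _+_ (trans (length-range 1 (ordT T)) (sym (length-map suc T))) (cong sum (map-∘ I)) ⟩
  lenP (map suc T) + sum (map (λ p → proj₁ p ∸ proj₂ p) (map (λ i → i , suc (par T i)) I))
    ≡⟨ cong (λ ps → lenP (map suc T) + sum (map (λ p → proj₁ p ∸ proj₂ p) ps))
            (sym (pairs-increasing inc)) ⟩
  probes (map suc T)
    ∎
  where
  I = interval 1 (ordT T)
  displacement : ∀ {i} → ptPar T i ≡ par T i × par T i < i → i ∸ ptPar T i ≡ suc (i ∸ suc (par T i))
  displacement (pt≡ , p<i) = trans (cong (_ ∸_) pt≡) (m<n⇒n∸m≡suc[n∸suc[m]] p<i)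

psa≡lucky : ∀ {T} → Increasing T → psa T ≡ lucky (map suc T)
psa≡lucky {T} inc = begin
  count (λ i → ptPar T i ≡ᵇ (i ∸ 1)) I
    ≡⟨ count-cong-local (All.zipWith lucky-vertex (ptPar≡par inc , parent< inc)) ⟩
  count (λ i → i ≡ᵇ suc (par T i)) I
    ≡⟨ sym (count-map (λ p → proj₁ p ≡ᵇ proj₂ p) (λ i → i , suc (par T i)) I) ⟩
  count (λ p → proj₁ p ≡ᵇ proj₂ p) (map (λ i → i , suc (par T i)) I)
    ≡⟨ cong (count (λ p → proj₁ p ≡ᵇ proj₂ p)) (sym (pairs-increasing inc)) ⟩
  lucky (map suc T)
    ∎
  where
  I = interval 1 (ordT T)
  lucky-vertex : ∀ {i} → ptPar T i ≡ par T i × par T i < i →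
                 (ptPar T i ≡ᵇ (i ∸ 1)) ≡ (i ≡ᵇ suc (par T i))
  lucky-vertex {suc i} (pt≡ , _) = trans (cong (_≡ᵇ i) pt≡) (≡ᵇ-sym (par T (suc i)) i)

degRoot≡ones : ∀ T → degRoot T ≡ ones (map suc T)
degRoot≡ones T = trans (count-par (_≡ᵇ 0) T) (sym (count-map (_≡ᵇ 1) suc T))

chseq≡mult : ∀ T → chseq T ≡ mult (map suc T)
chseq≡mult T = begin
  map (λ k → count (λ v → children T v ≡ᵇ k) (interval 0 n)) (interval 0 n)
    ≡⟨ map-cong same-count (interval 0 n) ⟩
  map (λ k → count (λ x → count (_≡ᵇ x) (map suc T) ≡ᵇ k) (interval 1 (suc n))) (interval 0 n)
    ≡⟨ cong (λ l → map (λ k → count (λ x → count (_≡ᵇ x) (map suc T) ≡ᵇ k) (interval 1 (suc l)))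
                       (interval 0 l))
            (sym (length-map suc T)) ⟩
  mult (map suc T)
    ∎
  where
  n = ordT T
  multiplicity : ∀ v → children T v ≡ count (_≡ᵇ suc v) (map suc T)
  multiplicity v = trans (count-par (_≡ᵇ v) T) (sym (count-map (_≡ᵇ suc v) suc T))

  same-count : ∀ k → count (λ v → children T v ≡ᵇ k) (interval 0 n)
                   ≡ count (λ x → count (_≡ᵇ x) (map suc T) ≡ᵇ k) (interval 1 (suc n))
  same-count k = begin
    count (λ v → children T v ≡ᵇ k) (interval 0 n)
      ≡⟨ count-cong-local (All.universal (λ v → cong (_≡ᵇ k) (multiplicity v)) (interval 0 n)) ⟩
    count (λ v → count (_≡ᵇ suc v) (map suc T) ≡ᵇ k) (interval 0 n)
      ≡⟨ sym (count-map (λ x → count (_≡ᵇ x) (map suc T) ≡ᵇ k) suc (interval 0 n)) ⟩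
    count (λ x → count (_≡ᵇ x) (map suc T) ≡ᵇ k) (map suc (interval 0 n))
      ≡⟨ cong (count (λ x → count (_≡ᵇ x) (map suc T) ≡ᵇ k)) (sym (range-suc 0 (suc n))) ⟩
    count (λ x → count (_≡ᵇ x) (map suc T) ≡ᵇ k) (interval 1 (suc n))
      ∎

treeMono≡pfMono : ∀ {T} → Increasing T → treeMono T ≡ pfMono (map suc T)
treeMono≡pfMono {T} inc =
  cong₂ _,_ (wait≡probes inc) (cong₂ _,_ (psa≡lucky inc) (cong₂ _,_ (degRoot≡ones T)
    (cong₂ _,_ (cong₂ wExp ord≡len (chseq≡mult T)) ord≡len)))
  where
  ord≡len : ordT T ≡ lenP (map suc T)
  ord≡len = sym (length-map suc T)

isPF∧isSubex-suc : ∀ s → (isPF (map suc s) ∧ isSubex (map suc s)) ≡ isIncTree s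
isPF∧isSubex-suc s = begin
  isPF (map suc s) ∧ isSubex (map suc s) ≡⟨ ∧-redundantˡ subex⇒PF ⟩
  isSubex (map suc s)                    ≡⟨ isSubex-suc s ⟩
  isIncreasing s                         ≡⟨ sym (isIncTree≡isIncreasing s) ⟩
  isIncTree s                            ∎
  where
  subex⇒PF : isSubex (map suc s) ≡ true → isPF (map suc s) ≡ true
  subex⇒PF e = isPF-increasing (isIncreasing⇒Increasing s (trans (sym (isSubex-suc s)) e))

largest-label-unused : ∀ n s → length s ≡ n → isIncTree s ≡ true → n ∉ s
largest-label-unused n s len e = subst (_∉ s) len
  (All¬⇒¬Any (All.map (λ x<n n≡x → <-irrefl (sym n≡x) x<n) (entries-< (isIncTree⇒Increasing s e))))

-- incTrees n draws entries from [0, n] and subexPFs n from [1, n]; no increasing tree of order n uses n.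
subexPFs≡map-suc-incTrees : ∀ n → subexPFs n ≡ map (map suc) (incTrees n)
subexPFs≡map-suc-incTrees n = begin
  bfilter Q (seqs n (interval 1 n))
    ≡⟨ cong (λ xs → bfilter Q (seqs n xs)) (range-suc 0 n) ⟩
  bfilter Q (seqs n (map suc (range 0 n)))
    ≡⟨ cong (bfilter Q) (seqs-map n suc (range 0 n)) ⟩
  bfilter Q (map (map suc) (seqs n (range 0 n)))
    ≡⟨ bfilter-map Q (map suc) (seqs n (range 0 n)) ⟩
  map (map suc) (bfilter (λ s → Q (map suc s)) (seqs n (range 0 n)))
    ≡⟨ cong (map (map suc)) (bfilter-cong-local (All.universal isPF∧isSubex-suc (seqs n (range 0 n)))) ⟩
  map (map suc) (bfilter isIncTree (seqs n (range 0 n)))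
    ≡⟨ cong (map (map suc)) (sym (bfilter-seqs-unused n isIncTree (range 0 n) n (largest-label-unused n))) ⟩
  map (map suc) (bfilter isIncTree (seqs n (range 0 n ++ [ n ])))
    ≡⟨ cong (λ xs → map (map suc) (bfilter isIncTree (seqs n xs))) (sym (range-snoc 0 n)) ⟩
  map (map suc) (incTrees n)
    ∎
  where
  Q : List ℕ → Bool
  Q π = isPF π ∧ isSubex π

treeMonos≡pfMonos : ∀ n → map treeMono (incTrees n) ≡ map pfMono (subexPFs n)
treeMonos≡pfMonos n = begin
  map treeMono (incTrees n)
    ≡⟨ map-cong-local (All.map (λ {T} → treeMono≡pfMono ∘ isIncTree⇒Increasing T)
                               (bfilter-All isIncTree (seqs n (interval 0 n)))) ⟩
  map (λ T → pfMono (map suc T)) (incTrees n)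
    ≡⟨ map-∘ (incTrees n) ⟩
  map pfMono (map (map suc) (incTrees n))
    ≡⟨ cong (map pfMono) (sym (subexPFs≡map-suc-incTrees n)) ⟩
  map pfMono (subexPFs n)
    ∎

prefSeq-image⇒subexceedant : ∀ {a} → Σ (List ℕ) (λ T → (isIncTree T ≡ true) × (prefSeq T ≡ a)) →
                             isSubex a ≡ true
prefSeq-image⇒subexceedant (T , isTree , refl) = begin
  isSubex (prefSeq T) ≡⟨ cong isSubex (prefSeq-increasing (isIncTree⇒Increasing T isTree)) ⟩
  isSubex (map suc T) ≡⟨ isSubex-suc T ⟩
  isIncreasing T      ≡⟨ sym (isIncTree≡isIncreasing T) ⟩
  isIncTree T         ≡⟨ isTree ⟩
  true                ∎

subexceedant⇒prefSeq-image : ∀ {a} → isSubex a ≡ true →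
                             Σ (List ℕ) (λ T → (isIncTree T ≡ true) × (prefSeq T ≡ a))
subexceedant⇒prefSeq-image {a} e =
  tree , trans (isIncTree≡isIncreasing tree) increasing-tree ,
  trans (prefSeq-increasing (isIncreasing⇒Increasing tree increasing-tree)) positive
  where
  tree = map pred a
  positive : map suc tree ≡ a
  positive = isSubex-positive e
  increasing-tree : isIncreasing tree ≡ true
  increasing-tree = trans (sym (isSubex-suc tree)) (trans (cong isSubex positive) e)

corollary4p4 : ((a : List ℕ) →
                  (Σ (List ℕ) (λ T → (isIncTree T ≡ true) × (prefSeq T ≡ a)))
                    ⇔ (isSubex a ≡ true))
               × ((n : ℕ) → map treeMono (incTrees n) ↭ map pfMono (subexPFs n))
corollary4p4 =
  (λ _ → mk⇔ prefSeq-image⇒subexceedant subexceedant⇒prefSeq-image) ,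
  (λ n → ↭-reflexive (treeMonos≡pfMonos n))
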